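{- Define $g:\mathbb N\to\mathbb N$ by $$g(n)=\begin{cases}\lfloor\varphi n\rfloor,& n\in R_{2,0},\\ \lfloor\varphi n-2\rfloor,& n\in R_{1,0},\\ \lfloor(\varphi-1)n+2\rfloor,& n\in R_{2,2},\\ \lfloor(\varphi-1)n+1\rfloor,& n\in R_{3,1}.\end{cases}$$ Then $g$ is a permutation of $\mathbb N$ of order $2$, i.e. $g\circ g=\mathrm{id}_{\mathbb N}$ and $g\neq \mathrm{id}_{\mathbb N}$.
   Context: Let $\varphi=\frac{1+\sqrt5}{2}$ and $\mathbb N=\{1,2,3,\dots\}$; $a(n)=\lfloor n\varphi\rfloor$. $F$ is the Fibonacci sequence, $F(0)=0$, $F(1)=F(2)=1$, $F(n)=F(n-1)+F(n-2)$. For $i\in\mathbb Z^{\geq0}$, $j\in\mathbb Z$, let $f_{i,j}(n)=F(i+1)a(n)+F(i)n-j$ ($n\in\mathbb N$) and $R_{i,j}=\{f_{i,j}(n)\mid n\in\mathbb N\}$. The sets $R_{1,0},R_{2,0},R_{2,2},R_{3,1}$ form a partition of $\mathbb N$. -}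

module Defs where

open import Data.Nat using (ℕ; zero; suc; _+_; _*_; _∸_; _≤ᵇ_)
open import Data.Bool using (Bool; true; false; if_then_else_; _∨_)
open import Data.List using (List; upTo; map)
open import Data.Bool.ListAction using (any)
open import Data.Integer as ℤ using (ℤ; +_)
open import Data.Product using (Σ; _×_)
open import Relation.Nullary using (does)
open import Relation.Binary.PropositionalEquality using (_≡_)

F : ℕ → ℕ
F zero = zero
F (suc zero) = 1
F (suc (suc n)) = F (suc n) + F n

-- leφ m n = true  iff  m ≤ n·φ, where φ = (1+√5)/2.
-- m ≤ nφ  ⇔  2m − n ≤ n√5  ⇔  2m ≤ n  or  (2m − n)² ≤ 5n².
leφ : ℕ → ℕ → Bool
leφ m n = (2 * m ≤ᵇ n) ∨ ((2 * m ∸ n) * (2 * m ∸ n) ≤ᵇ 5 * (n * n))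

maxBelow : (ℕ → Bool) → ℕ → ℕ
maxBelow p zero = zero
maxBelow p (suc k) = if p (suc k) then suc k else maxBelow p k

-- a n = ⌊ n φ ⌋ : the largest m ≤ 2n with m ≤ nφ (note nφ < 2n + 1).
a : ℕ → ℕ
a n = maxBelow (λ m → leφ m n) (2 * n)

f : ℕ → ℤ → ℕ → ℤ
f i j n = (+ (F (suc i) * a n + F i * n)) ℤ.- j

R : ℕ → ℤ → ℕ → Set
R i j k = Σ ℕ (λ n → (1 Data.Nat.≤ n) × (f i j n ≡ + k))

-- Boolean membership test for R_{i,j} used to define g by cases.
-- For the four relevant (i,j), f_{i,j}(m) ≥ m for m ≥ 1, so searching the
-- witnesses m ∈ {1,…,k} is complete.
inR : ℕ → ℤ → ℕ → Bool
inR i j k = any (λ m → does (f i j (suc m) ℤ.≟ + k)) (upTo k)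

-- g(n):  n ∈ R_{2,0}: ⌊φn⌋ = a n
--        n ∈ R_{1,0}: ⌊φn − 2⌋ = a n − 2
--        n ∈ R_{2,2}: ⌊(φ−1)n + 2⌋ = a n − n + 2
--        n ∈ R_{3,1}: ⌊(φ−1)n + 1⌋ = a n − n + 1
-- (all these values are ≥ 0 on their cases, so truncated subtraction is exact;
--  the final default 0 is never reached for n ≥ 1 since the R's partition ℕ)
g : ℕ → ℕ
g n =
  if inR 2 (+ 0) n then a n
  else if inR 1 (+ 0) n then a n ∸ 2
  else if inR 2 (+ 2) n then (a n + 2) ∸ n
  else if inR 3 (+ 1) n then (a n + 1) ∸ n
  else 0

-- Write k ≤ mφ for leφ k m ≡ true. Because φ² = φ + 1 and φ is irrational, the step
-- S(k, m) = (k + m, k) moves every nonzero lattice point to the other side of the line k = mφ,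
-- and each side of that line is closed under addition. For m ≥ 1 and k = a m the point (k, m)
-- lies below the line and (k + 1, m) above it; applying S², S³ and S⁴ to both points pins down
-- a at k + m, 2k + m, 2k + m − 2 and 3k + 2m − 1, the elements of R₁₀, R₂₀, R₂₂ and R₃₁ with
-- witness m, and shows that g exchanges the first with the third and the second with the fourth.
-- The same computation puts the four points into the four bands of {nφ} cut out by 2 − φ,
-- 7 − 4φ and 4 − 2φ, so the four sets are disjoint and g always takes the intended branch.
-- Conversely, the band of an arbitrary n ≥ 1 says which power of S to invert at (a n, n), and
-- the preimage is (a m, m) for some m ≥ 1, so every n ≥ 1 lies in one of the exchanged pairs.

module Submission where

open import Defs
open import Data.Nat using (ℕ; _≤_)
open import Data.Product using (Σ; _×_)
open import Relation.Binary.PropositionalEquality using (_≡_; _≢_)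

open import Data.Bool using (Bool; true; false; not; T; _∨_; _≟_; if_then_else_)
open import Data.Bool.Properties using (T-≡; ∨-zeroʳ; not-involutive; not-injective; not-¬; ¬-not)
import Data.Integer as ℤ
import Data.Integer.Properties as ℤ
import Data.Integer.Tactic.RingSolver as ℤ-Solver
open import Data.List using ([]; _∷_; upTo)
open import Data.List.Membership.Propositional using (lose)
open import Data.List.Membership.Propositional.Properties using (∈-upTo⁺)
open import Data.List.Relation.Unary.Any using (satisfied)
open import Data.List.Relation.Unary.Any.Properties using (any⁺; any⁻)
open import Data.Nat hiding (_≟_)
open import Data.Nat.Induction using (<-wellFounded)
open import Data.Nat.Properties hiding (_≟_)
open import Algebra.Properties.CommutativeSemigroup +-commutativeSemigroup using (interchange)
open import Data.Nat.Tactic.RingSolver using (solve-∀; solve)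
open import Data.Product using (_,_; proj₁; proj₂)
open import Data.Sum using (inj₁; inj₂)
open import Function.Bundles using (_⇔_; mk⇔; Equivalence)
import Function.Properties.Equivalence as ⇔
open import Induction.WellFounded using (Acc; acc)
open import Relation.Binary.PropositionalEquality
open import Relation.Nullary using (¬_; contradiction; yes; no)
open import Relation.Nullary.Decidable using (toWitness; dec-true; isYes≗does)

open Equivalence using (to; from)

-- Comparison with √5

infix 4 _≤√5·_

_≤√5·_ : ℕ → ℕ → Set
x ≤√5· y = x * x ≤ 5 * (y * y)

square-cancel-≤ : ∀ x y → x * x ≤ y * y → x ≤ y
square-cancel-≤ x y sq with x ≤? y
... | yes x≤y = x≤y
... | no x≰y = contradiction sq (<⇒≱ (*-mono-< y<x y<x))
  where
  y<x : y < x
  y<x = ≰⇒> x≰y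

≤√5·-anti-mono : ∀ {x y x′ y′} → x′ ≤ x → y ≤ y′ → x ≤√5· y → x′ ≤√5· y′
≤√5·-anti-mono x′≤x y≤y′ h =
  ≤-trans (*-mono-≤ x′≤x x′≤x) (≤-trans h (*-monoʳ-≤ 5 (*-mono-≤ y≤y′ y≤y′)))

-- Cauchy–Schwarz: x x′ ≤ 5 y y′, since (x x′)² ≤ (5 y y′)².
≤√5·-+ : ∀ x y x′ y′ → x ≤√5· y → x′ ≤√5· y′ → x + x′ ≤√5· y + y′
≤√5·-+ x y x′ y′ h h′ = begin
  (x + x′) * (x + x′)                              ≡⟨ solve (x ∷ x′ ∷ []) ⟩
  x * x + 2 * (x * x′) + x′ * x′                   ≤⟨ +-mono-≤ (+-mono-≤ h (*-monoʳ-≤ 2 cross)) h′ ⟩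
  5 * (y * y) + 2 * (5 * (y * y′)) + 5 * (y′ * y′)  ≡⟨ solve (y ∷ y′ ∷ []) ⟩
  5 * ((y + y′) * (y + y′))                        ∎
  where
  open ≤-Reasoning
  cross : x * x′ ≤ 5 * (y * y′)
  cross = square-cancel-≤ (x * x′) (5 * (y * y′)) (begin
    (x * x′) * (x * x′)                    ≡⟨ solve (x ∷ x′ ∷ []) ⟩
    (x * x) * (x′ * x′)                    ≤⟨ *-mono-≤ h h′ ⟩
    (5 * (y * y)) * (5 * (y′ * y′))        ≡⟨ solve (y ∷ y′ ∷ []) ⟩
    (5 * (y * y′)) * (5 * (y * y′))        ∎)

∸-+-≤ : ∀ x y x′ y′ → (x + y) ∸ (x′ + y′) ≤ (x ∸ x′) + (y ∸ y′)
∸-+-≤ x y x′ y′ = m≤n+o⇒m∸n≤o (x + y) (x′ + y′) (begin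
  x + y                                ≤⟨ +-mono-≤ (m≤n+m∸n x x′) (m≤n+m∸n y y′) ⟩
  (x′ + (x ∸ x′)) + (y′ + (y ∸ y′))    ≡⟨ interchange x′ (x ∸ x′) y′ (y ∸ y′) ⟩
  (x′ + y′) + ((x ∸ x′) + (y ∸ y′))    ∎)
  where open ≤-Reasoning

leφ-√5 : ∀ k m → leφ k m ≡ true ⇔ 2 * k ∸ m ≤√5· m
leφ-√5 k m = mk⇔ from-leφ to-leφ
  where
  from-leφ : leφ k m ≡ true → 2 * k ∸ m ≤√5· m
  from-leφ h with 2 * k ≤ᵇ m in 2k≤ᵇm
  ... | true rewrite m≤n⇒m∸n≡0 (≤ᵇ⇒≤ (2 * k) m (T-≡ .from 2k≤ᵇm)) = z≤n
  ... | false = ≤ᵇ⇒≤ _ _ (T-≡ .from h)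
  to-leφ : 2 * k ∸ m ≤√5· m → leφ k m ≡ true
  to-leφ h = trans (cong ((2 * k ≤ᵇ m) ∨_) (T-≡ .to (≤⇒≤ᵇ h))) (∨-zeroʳ _)

-- With d = 2k − m, both sides say 4k² ≤ 4km + 4m², i.e. d² ≤ 5m².
quadratic-√5 : ∀ k m d → 2 * k ≡ d + m → k * k ≤ k * m + m * m ⇔ d ≤√5· m
quadratic-√5 k m d 2k≡d+m = mk⇔
  (λ h → +-cancelʳ-≤ c _ _ (subst₂ _≤_ four-k² four-rhs (*-monoʳ-≤ 4 h)))
  (λ h → *-cancelˡ-≤ 4 (subst₂ _≤_ (sym four-k²) (sym four-rhs) (+-monoˡ-≤ c h)))
  where
  open ≡-Reasoning
  c : ℕ
  c = 2 * (d * m) + m * m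
  four-k² : 4 * (k * k) ≡ d * d + c
  four-k² = begin
    4 * (k * k)        ≡⟨ solve (k ∷ []) ⟩
    (2 * k) * (2 * k)  ≡⟨ cong (λ z → z * z) 2k≡d+m ⟩
    (d + m) * (d + m)  ≡⟨ solve (d ∷ m ∷ []) ⟩
    d * d + (2 * (d * m) + m * m)  ∎
  four-rhs : 4 * (k * m + m * m) ≡ 5 * (m * m) + c
  four-rhs = begin
    4 * (k * m + m * m)                ≡⟨ solve (k ∷ m ∷ []) ⟩
    2 * ((2 * k) * m) + 4 * (m * m)    ≡⟨ cong (λ z → 2 * (z * m) + 4 * (m * m)) 2k≡d+m ⟩
    2 * ((d + m) * m) + 4 * (m * m)    ≡⟨ solve (d ∷ m ∷ []) ⟩
    5 * (m * m) + (2 * (d * m) + m * m) ∎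

leφ-quadratic : ∀ k m → leφ k m ≡ true ⇔ k * k ≤ k * m + m * m
leφ-quadratic k m with 2 * k ≤? m
... | no 2k≰m = ⇔.trans (leφ-√5 k m) (⇔.sym (quadratic-√5 k m (2 * k ∸ m) (sym (m∸n+n≡m (<⇒≤ (≰⇒> 2k≰m))))))
... | yes 2k≤m = mk⇔ (λ _ → k²≤km) (λ _ → leφ-√5 k m .from (subst (_≤√5· m) (sym (m≤n⇒m∸n≡0 2k≤m)) z≤n))
  where
  k²≤km : k * k ≤ k * m + m * m
  k²≤km = ≤-trans (*-monoʳ-≤ k (≤-trans (m≤m+n k (k + 0)) 2k≤m)) (m≤m+n (k * m) (m * m))

golden-descent : ∀ m d → (m + d) * (m + d) ≡ (m + d) * m + m * m → m * m ≡ m * d + d * d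
golden-descent m d eq = sym (+-cancelˡ-≡ (m * m + m * d) _ _ (begin
  (m * m + m * d) + (m * d + d * d)  ≡⟨ solve (m ∷ d ∷ []) ⟩
  (m + d) * (m + d)                  ≡⟨ eq ⟩
  (m + d) * m + m * m                ≡⟨ solve (m ∷ d ∷ []) ⟩
  (m * m + m * d) + m * m            ∎))
  where open ≡-Reasoning

golden-irrational : ∀ k m → 1 ≤ k + m → k * k ≢ k * m + m * m
golden-irrational zero    zero    ()
golden-irrational (suc k) zero    _ eq = contradiction (trans eq (cong (_+ 0) (*-zeroʳ (suc k)))) λ ()
golden-irrational k       (suc m) _    = descent k m (<-wellFounded k)
  where
  descent : ∀ k m → Acc _<_ k → k * k ≢ k * suc m + suc m * suc m
  descent k m (acc smaller) eq
    with m≤n⇒∃[o]m+o≡n (square-cancel-≤ (suc m) k (subst (suc m * suc m ≤_) (sym eq) (m≤n+m _ _)))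
  ... | zero  , refl =
    contradiction (trans (golden-descent (suc m) 0 eq) (cong (_+ 0) (*-zeroʳ (suc m)))) λ ()
  ... | suc d , refl = descent (suc m) d (smaller (m<m+n (suc m) z<s)) (golden-descent (suc m) (suc d) eq)

swap-quadratic : ∀ k m → (k + m) * (k + m) ≤ (k + m) * k + k * k ⇔ k * m + m * m ≤ k * k
swap-quadratic k m = mk⇔
  (λ h → +-cancelʳ-≤ c _ _ (subst₂ _≤_ lhs rhs h))
  (λ h → subst₂ _≤_ (sym lhs) (sym rhs) (+-monoˡ-≤ c h))
  where
  c : ℕ
  c = k * k + k * m
  lhs : (k + m) * (k + m) ≡ (k * m + m * m) + (k * k + k * m)
  lhs = solve (k ∷ m ∷ [])
  rhs : (k + m) * k + k * k ≡ k * k + (k * k + k * m)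
  rhs = solve (k ∷ m ∷ [])

-- (k + m) − kφ = (1 − φ)(k − mφ), and the point is never on the line by golden-irrational.
leφ-swap : ∀ k m → 1 ≤ k + m → leφ (k + m) k ≡ not (leφ k m)
leφ-swap k m 1≤k+m with leφ k m in below
... | true = ¬-not λ above → golden-irrational k m 1≤k+m (≤-antisym
  (leφ-quadratic k m .to below)
  (swap-quadratic k m .to (leφ-quadratic (k + m) k .to above)))
... | false = leφ-quadratic (k + m) k .from (swap-quadratic k m .from
  (≰⇒≥ λ h → not-¬ below (leφ-quadratic k m .from h)))

subst-leφ : ∀ {k m k′ m′ b} → k ≡ k′ → m ≡ m′ → leφ k m ≡ b → leφ k′ m′ ≡ b
subst-leφ refl refl h = h

leφ-+-true : ∀ k m k′ m′ → leφ k m ≡ true → leφ k′ m′ ≡ true → leφ (k + k′) (m + m′) ≡ true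
leφ-+-true k m k′ m′ h h′ = leφ-√5 (k + k′) (m + m′) .from
  (≤√5·-anti-mono bound (≤-refl {m + m′})
    (≤√5·-+ (2 * k ∸ m) m (2 * k′ ∸ m′) m′ (leφ-√5 k m .to h) (leφ-√5 k′ m′ .to h′)))
  where
  bound : 2 * (k + k′) ∸ (m + m′) ≤ (2 * k ∸ m) + (2 * k′ ∸ m′)
  bound = subst (λ z → z ∸ (m + m′) ≤ (2 * k ∸ m) + (2 * k′ ∸ m′)) (sym (*-distribˡ-+ 2 k k′))
                (∸-+-≤ (2 * k) (2 * k′) m m′)

leφ-false⇒nonzero : ∀ k m → leφ k m ≡ false → 1 ≤ k + m
leφ-false⇒nonzero zero    zero    ()
leφ-false⇒nonzero zero    (suc m) _ = s≤s z≤n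
leφ-false⇒nonzero (suc k) m       _ = s≤s z≤n

leφ-+ : ∀ b k m k′ m′ → leφ k m ≡ b → leφ k′ m′ ≡ b → leφ (k + k′) (m + m′) ≡ b
leφ-+ true = leφ-+-true
leφ-+ false k m k′ m′ h h′ = not-injective (begin
  not (leφ (k + k′) (m + m′))        ≡⟨ sym (leφ-swap (k + k′) (m + m′) nonzero) ⟩
  leφ (k + k′ + (m + m′)) (k + k′)   ≡⟨ cong (λ z → leφ z (k + k′)) (interchange k k′ m m′) ⟩
  leφ (k + m + (k′ + m′)) (k + k′)   ≡⟨ leφ-+-true (k + m) k (k′ + m′) k′ (swapped k m h) (swapped k′ m′ h′) ⟩
  true                               ∎)
  where
  open ≡-Reasoning
  swapped : ∀ k m → leφ k m ≡ false → leφ (k + m) k ≡ true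
  swapped k m h = trans (leφ-swap k m (leφ-false⇒nonzero k m h)) (cong not h)
  nonzero : 1 ≤ k + k′ + (m + m′)
  nonzero = ≤-trans (leφ-false⇒nonzero k m h) (+-mono-≤ (m≤m+n k k′) (m≤m+n m m′))

leφ-cancel : ∀ b k m k′ m′ → leφ (k + k′) (m + m′) ≡ b → leφ k′ m′ ≡ not b → leφ k m ≡ b
leφ-cancel b k m k′ m′ sum part with leφ k m ≟ b
... | yes eq = eq
... | no neq = contradiction (leφ-+ (not b) k m k′ m′ (¬-not neq) part) (not-¬ sum)

leφ-cancel-suc : ∀ y x c d → leφ (y + suc c) (x + d) ≡ false → leφ c d ≡ true → leφ (suc y) x ≡ false
leφ-cancel-suc y x c d h = leφ-cancel false (suc y) x c d (subst-leφ (+-suc y c) refl h)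

leφ-mono : ∀ {k m k′ m′} → k′ ≤ k → m ≤ m′ → leφ k m ≡ true → leφ k′ m′ ≡ true
leφ-mono {k} {m} {k′} {m′} k′≤k m≤m′ h = leφ-√5 k′ m′ .from
  (≤√5·-anti-mono (∸-mono (*-monoʳ-≤ 2 k′≤k) m≤m′) m≤m′ (leφ-√5 k m .to h))

leφ-scale : ∀ c b k m → leφ k m ≡ b → leφ (suc c * k) (suc c * m) ≡ b
leφ-scale zero    b k m h = subst₂ (λ x y → leφ x y ≡ b) (sym (+-identityʳ k)) (sym (+-identityʳ m)) h
leφ-scale (suc c) b k m h = leφ-+ b k m _ _ h (leφ-scale c b k m h)

leφ-separates : ∀ p q x y → 1 ≤ q → 1 ≤ y → leφ p q ≡ true → leφ x y ≡ false → p * y < q * x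
leφ-separates p (suc q) x (suc y) _ _ below above = ≰⇒> λ qx≤py →
  not-¬ (leφ-scale q false x (suc y) above)
        (leφ-mono (subst (suc q * x ≤_) (*-comm p (suc y)) qx≤py) (≤-reflexive (*-comm (suc y) (suc q)))
                  (leφ-scale y true p (suc q) below))

leφ-diag : ∀ n → leφ n n ≡ true
leφ-diag n = leφ-quadratic n n .from (m≤m+n (n * n) (n * n))

-- The floor function a

maxBelow-holds : ∀ (p : ℕ → Bool) (b : ℕ) → p 0 ≡ true → p (maxBelow p b) ≡ true
maxBelow-holds p zero    h = h
maxBelow-holds p (suc b) h with p (suc b) in psb
... | true  = psb
... | false = maxBelow-holds p b h

maxBelow-maximal : ∀ (p : ℕ → Bool) (b y : ℕ) → y ≤ b → p y ≡ true → y ≤ maxBelow p b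
maxBelow-maximal p zero    y y≤0 _ = y≤0
maxBelow-maximal p (suc b) y y≤b py with p (suc b) in psb
... | true = y≤b
... | false with m≤n⇒m<n∨m≡n y≤b
...   | inj₁ y<sb = maxBelow-maximal p b y (≤-pred y<sb) py
...   | inj₂ refl = contradiction (trans (sym psb) py) λ ()

leφ-2n+1 : ∀ n → leφ (suc (2 * n)) n ≡ false
leφ-2n+1 n = ¬-not λ h → <⇒≱ gap (leφ-quadratic (suc (2 * n)) n .to h)
  where
  square : ∀ n → (1 + 2 * n) * (1 + 2 * n) ≡ ((1 + 2 * n) * n + n * n) + (1 + (n * n + 3 * n))
  square = solve-∀
  gap : suc (2 * n) * n + n * n < suc (2 * n) * suc (2 * n)
  gap = subst (suc (2 * n) * n + n * n <_) (sym (square n)) (m<m+n _ z<s)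

leφ-≤ : ∀ n x y → leφ x n ≡ true → leφ (suc y) n ≡ false → x ≤ y
leφ-≤ n x y below above = ≮⇒≥ λ y<x → not-¬ above (leφ-mono y<x ≤-refl below)

a-below : ∀ n → leφ (a n) n ≡ true
a-below n = maxBelow-holds (λ k → leφ k n) (2 * n) refl

a-above : ∀ n → leφ (suc (a n)) n ≡ false
a-above n = ¬-not λ h →
  <-irrefl refl (maxBelow-maximal (λ k → leφ k n) (2 * n) (suc (a n)) (leφ-≤ n _ _ h (leφ-2n+1 n)) h)

a-unique : ∀ n x → leφ x n ≡ true → leφ (suc x) n ≡ false → a n ≡ x
a-unique n x below above = ≤-antisym (leφ-≤ n (a n) x (a-below n) above) (leφ-≤ n x (a n) below (a-above n))

n≤a[n] : ∀ n → n ≤ a n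
n≤a[n] n = leφ-≤ n n (a n) (leφ-diag n) (a-above n)

a[n]<2n : ∀ n → 1 ≤ n → a n < 2 * n
a[n]<2n n 1≤n = subst₂ _<_ (*-identityʳ (a n)) (*-comm n 2)
  (leφ-separates (a n) n 2 1 1≤n (s≤s z≤n) (a-below n) refl)

3n<2[1+a[n]] : ∀ n → 1 ≤ n → 3 * n < 2 * suc (a n)
3n<2[1+a[n]] n 1≤n = leφ-separates 3 2 (suc (a n)) n (s≤s z≤n) 1≤n refl (a-above n)

-- Powers of the golden step

leφ-step² : ∀ k m → 1 ≤ k + m → leφ (2 * k + m) (k + m) ≡ leφ k m
leφ-step² k m 1≤k+m = begin
  leφ (2 * k + m) (k + m)  ≡⟨ cong (λ z → leφ z (k + m)) regroup ⟩
  leφ (k + m + k) (k + m)  ≡⟨ leφ-swap (k + m) k (≤-trans 1≤k+m (m≤m+n (k + m) k)) ⟩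
  not (leφ (k + m) k)      ≡⟨ cong not (leφ-swap k m 1≤k+m) ⟩
  not (not (leφ k m))      ≡⟨ not-involutive _ ⟩
  leφ k m                  ∎
  where
  open ≡-Reasoning
  regroup : 2 * k + m ≡ k + m + k
  regroup = solve (k ∷ m ∷ [])

leφ-step³ : ∀ k m → 1 ≤ k + m → leφ (3 * k + 2 * m) (2 * k + m) ≡ not (leφ k m)
leφ-step³ k m 1≤k+m = begin
  leφ (3 * k + 2 * m) (2 * k + m)        ≡⟨ cong (λ z → leφ z (2 * k + m)) regroup ⟩
  leφ (2 * k + m + (k + m)) (2 * k + m)  ≡⟨ leφ-swap (2 * k + m) (k + m) 1≤3k+2m ⟩
  not (leφ (2 * k + m) (k + m))          ≡⟨ cong not (leφ-step² k m 1≤k+m) ⟩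
  not (leφ k m)                          ∎
  where
  open ≡-Reasoning
  1≤3k+2m : 1 ≤ 2 * k + m + (k + m)
  1≤3k+2m = ≤-trans 1≤k+m (m≤n+m (k + m) (2 * k + m))
  regroup : 3 * k + 2 * m ≡ 2 * k + m + (k + m)
  regroup = solve (k ∷ m ∷ [])

leφ-step⁴ : ∀ k m → 1 ≤ k + m → leφ (5 * k + 3 * m) (3 * k + 2 * m) ≡ leφ k m
leφ-step⁴ k m 1≤k+m = begin
  leφ (5 * k + 3 * m) (3 * k + 2 * m)                    ≡⟨ cong₂ leφ regroup₁ regroup₂ ⟩
  leφ (2 * (2 * k + m) + (k + m)) (2 * k + m + (k + m))  ≡⟨ leφ-step² (2 * k + m) (k + m) 1≤3k+2m ⟩
  leφ (2 * k + m) (k + m)                                ≡⟨ leφ-step² k m 1≤k+m ⟩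
  leφ k m                                                ∎
  where
  open ≡-Reasoning
  1≤3k+2m : 1 ≤ 2 * k + m + (k + m)
  1≤3k+2m = ≤-trans 1≤k+m (m≤n+m (k + m) (2 * k + m))
  regroup₁ : 5 * k + 3 * m ≡ 2 * (2 * k + m) + (k + m)
  regroup₁ = solve (k ∷ m ∷ [])
  regroup₂ : 3 * k + 2 * m ≡ 2 * k + m + (k + m)
  regroup₂ = solve (k ∷ m ∷ [])

leφ-step²-suc : ∀ k m → leφ (2 * k + m + 2) (k + m + 1) ≡ leφ (suc k) m
leφ-step²-suc k m = trans (cong₂ leφ e₁ e₂) (leφ-step² (suc k) m (s≤s z≤n))
  where
  e₁ : 2 * k + m + 2 ≡ 2 * suc k + m
  e₁ = solve (k ∷ m ∷ [])
  e₂ : k + m + 1 ≡ suc k + m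
  e₂ = solve (k ∷ m ∷ [])

leφ-step³-suc : ∀ k m → leφ (3 * k + 2 * m + 3) (2 * k + m + 2) ≡ not (leφ (suc k) m)
leφ-step³-suc k m = trans (cong₂ leφ e₁ e₂) (leφ-step³ (suc k) m (s≤s z≤n))
  where
  e₁ : 3 * k + 2 * m + 3 ≡ 3 * suc k + 2 * m
  e₁ = solve (k ∷ m ∷ [])
  e₂ : 2 * k + m + 2 ≡ 2 * suc k + m
  e₂ = solve (k ∷ m ∷ [])

leφ-step⁴-suc : ∀ k m → leφ (5 * k + 3 * m + 5) (3 * k + 2 * m + 3) ≡ leφ (suc k) m
leφ-step⁴-suc k m = trans (cong₂ leφ e₁ e₂) (leφ-step⁴ (suc k) m (s≤s z≤n))
  where
  e₁ : 5 * k + 3 * m + 5 ≡ 5 * suc k + 3 * m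
  e₁ = solve (k ∷ m ∷ [])
  e₂ : 3 * k + 2 * m + 3 ≡ 3 * suc k + 2 * m
  e₂ = solve (k ∷ m ∷ [])

a-via-step² : ∀ k m → 1 ≤ m →
  leφ (2 * k + m) (k + m) ≡ true → leφ (2 * k + m + 2) (k + m + 1) ≡ false → a m ≡ k
a-via-step² k m 1≤m lower upper = a-unique m k
  (trans (sym (leφ-step² k m (≤-trans 1≤m (m≤n+m m k)))) lower)
  (trans (sym (leφ-step²-suc k m)) upper)

a-via-step³ : ∀ k m → 1 ≤ m →
  leφ (3 * k + 2 * m) (2 * k + m) ≡ false → leφ (3 * k + 2 * m + 3) (2 * k + m + 2) ≡ true → a m ≡ k
a-via-step³ k m 1≤m lower upper = a-unique m k
  (not-injective (trans (sym (leφ-step³ k m (≤-trans 1≤m (m≤n+m m k)))) lower))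
  (not-injective (trans (sym (leφ-step³-suc k m)) upper))

a-via-step⁴ : ∀ k m → 1 ≤ m →
  leφ (5 * k + 3 * m) (3 * k + 2 * m) ≡ true → leφ (5 * k + 3 * m + 5) (3 * k + 2 * m + 3) ≡ false → a m ≡ k
a-via-step⁴ k m 1≤m lower upper = a-unique m k
  (trans (sym (leφ-step⁴ k m (≤-trans 1≤m (m≤n+m m k)))) lower)
  (trans (sym (leφ-step⁴-suc k m)) upper)

f-≡ : ∀ i j m x → f i (ℤ.+ j) m ≡ ℤ.+ x ⇔ F (suc i) * a m + F i * m ≡ x + j
f-≡ i j m x = mk⇔
  (λ eq → ℤ.+-injective (trans (minus-plus (ℤ.+ value) (ℤ.+ j)) (cong (ℤ._+ ℤ.+ j) eq)))
  (λ eq → trans (cong (λ z → ℤ.+ z ℤ.- ℤ.+ j) eq) (plus-minus (ℤ.+ x) (ℤ.+ j)))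
  where
  value : ℕ
  value = F (suc i) * a m + F i * m
  minus-plus : ∀ X J → X ≡ X ℤ.- J ℤ.+ J
  minus-plus = ℤ-Solver.solve-∀
  plus-minus : ∀ X J → X ℤ.+ J ℤ.- J ≡ X
  plus-minus = ℤ-Solver.solve-∀

inR-sound : ∀ i j x → inR i j x ≡ true → R i j x
inR-sound i j x h with satisfied (any⁻ _ (upTo x) (T-≡ .from h))
... | m , found = suc m , s≤s z≤n , toWitness (subst T (sym (isYes≗does (f i j (suc m) ℤ.≟ ℤ.+ x))) found)

inR-complete : ∀ i j x m → 1 ≤ m → m ≤ x → f i j m ≡ ℤ.+ x → inR i j x ≡ true
inR-complete i j x (suc m) _ m<x eq =
  T-≡ .to (any⁺ _ (lose (∈-upTo⁺ m<x) (T-≡ .from (dec-true (f i j (suc m) ℤ.≟ ℤ.+ x) eq))))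

inR-false : ∀ i j x → ¬ R i j x → inR i j x ≡ false
inR-false i j x ¬r = ¬-not λ t → ¬r (inR-sound i j x t)

-- Orbits

-- band c d n ≡ true  iff  {nφ} ≥ c − dφ, since a n = nφ − {nφ}.
-- R₁₀, R₃₁, R₂₂, R₂₀ turn out to be the n with {nφ} in
-- (0, 2 − φ), (2 − φ, 7 − 4φ), (7 − 4φ, 4 − 2φ), (4 − 2φ, 1).
band : ℕ → ℕ → ℕ → Bool
band c d n = leφ (a n + c) (n + d)

band-4-2⇒7-4 : ∀ n → band 4 2 n ≡ true → band 7 4 n ≡ true
band-4-2⇒7-4 n h = subst-leφ (+-assoc (a n) 4 3) (+-assoc n 2 2) (leφ-+ true (a n + 4) (n + 2) 3 2 h refl)

band-7-4⇒2-1 : ∀ n → band 7 4 n ≡ true → band 2 1 n ≡ true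
band-7-4⇒2-1 n h =
  leφ-cancel true (a n + 2) (n + 1) 5 3 (subst-leφ (sym (+-assoc (a n) 2 5)) (sym (+-assoc n 1 3)) h) refl

+-shift : ∀ {y t} c e → y + c ≡ t → y + (c + e) ≡ t + e
+-shift {y} c e eq = trans (sym (+-assoc y c e)) (cong (_+ e) eq)

module Orbit {k m : ℕ} (1≤m : 1 ≤ m) (a≡k : a m ≡ k) where

  below : leφ k m ≡ true
  below = subst (λ z → leφ z m ≡ true) a≡k (a-below m)

  above : leφ (suc k) m ≡ false
  above = subst (λ z → leφ (suc z) m ≡ false) a≡k (a-above m)

  1≤k : 1 ≤ k
  1≤k = ≤-trans 1≤m (leφ-≤ m m k (leφ-diag m) above)

  1≤k+m : 1 ≤ k + m
  1≤k+m = ≤-trans 1≤m (m≤n+m m k)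

  lower² : leφ (2 * k + m) (k + m) ≡ true
  lower² = trans (leφ-step² k m 1≤k+m) below

  upper² : leφ (2 * k + m + 2) (k + m + 1) ≡ false
  upper² = trans (leφ-step²-suc k m) above

  lower³ : leφ (3 * k + 2 * m) (2 * k + m) ≡ false
  lower³ = trans (leφ-step³ k m 1≤k+m) (cong not below)

  upper³ : leφ (3 * k + 2 * m + 3) (2 * k + m + 2) ≡ true
  upper³ = trans (leφ-step³-suc k m) (cong not above)

  lower⁴ : leφ (5 * k + 3 * m) (3 * k + 2 * m) ≡ true
  lower⁴ = trans (leφ-step⁴ k m 1≤k+m) below

  upper⁴ : leφ (5 * k + 3 * m + 5) (3 * k + 2 * m + 3) ≡ false
  upper⁴ = trans (leφ-step⁴-suc k m) above

  2≤2k+m : 2 ≤ 2 * k + m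
  2≤2k+m = ≤-trans (*-monoʳ-≤ 2 1≤k) (m≤m+n (2 * k) m)

  5≤3k+2m : 5 ≤ 3 * k + 2 * m
  5≤3k+2m = +-mono-≤ (*-monoʳ-≤ 3 1≤k) (*-monoʳ-≤ 2 1≤m)

  z w : ℕ
  z = 2 * k + m ∸ 2
  w = 3 * k + 2 * m ∸ 1

  z+2≡ : z + 2 ≡ 2 * k + m
  z+2≡ = m∸n+n≡m 2≤2k+m

  w+1≡ : w + 1 ≡ 3 * k + 2 * m
  w+1≡ = m∸n+n≡m (≤-trans (s≤s z≤n) 5≤3k+2m)

  a-k+m : a (k + m) ≡ 2 * k + m
  a-k+m = a-unique (k + m) (2 * k + m) lower² (leφ-cancel-suc (2 * k + m) (k + m) 1 1 upper² refl)

  a-2k+m : a (2 * k + m) ≡ w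
  a-2k+m = a-unique (2 * k + m) w
    (leφ-cancel true w (2 * k + m) 4 2 (subst-leφ (sym (+-shift 1 3 w+1≡)) refl upper³) refl)
    (subst-leφ (sym (trans (+-comm 1 w) w+1≡)) refl lower³)

  a-z : a z + 4 ≡ 3 * k + 2 * m
  a-z = trans (cong (_+ 4) a-z≡y) y+4≡
    where
    y : ℕ
    y = 3 * k + 2 * m ∸ 4
    y+4≡ : y + 4 ≡ 3 * k + 2 * m
    y+4≡ = m∸n+n≡m (≤-trans (n≤1+n 4) 5≤3k+2m)
    a-z≡y : a z ≡ y
    a-z≡y = a-unique z y
      (leφ-cancel true y z 7 4 (subst-leφ (sym (+-shift 4 3 y+4≡)) (sym (+-shift 2 2 z+2≡)) upper³) refl)
      (leφ-cancel-suc y z 3 2 (subst-leφ (sym y+4≡) (sym z+2≡) lower³) refl)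

  a-w : a w + 2 ≡ 5 * k + 3 * m
  a-w = trans (cong (_+ 2) a-w≡y) y+2≡
    where
    y : ℕ
    y = 5 * k + 3 * m ∸ 2
    y+2≡ : y + 2 ≡ 5 * k + 3 * m
    y+2≡ = m∸n+n≡m (≤-trans (s≤s (s≤s z≤n)) (≤-trans (*-monoʳ-≤ 5 1≤k) (m≤m+n (5 * k) (3 * m))))
    a-w≡y : a w ≡ y
    a-w≡y = a-unique w y
      (leφ-cancel true y w 2 1 (subst-leφ (sym y+2≡) (sym w+1≡) lower⁴) refl)
      (leφ-cancel-suc y w 6 4 (subst-leφ (sym (+-shift 2 5 y+2≡)) (sym (+-shift 1 3 w+1≡)) upper⁴) refl)

  band-k+m : band 2 1 (k + m) ≡ false
  band-k+m = subst-leφ (cong (_+ 2) (sym a-k+m)) refl upper²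

  band-2k+m : band 4 2 (2 * k + m) ≡ true
  band-2k+m = subst-leφ (sym (trans (cong (_+ 4) a-2k+m) (+-shift 1 3 w+1≡))) refl upper³

  band-z : band 7 4 z ≡ true × band 4 2 z ≡ false
  band-z = subst-leφ (sym (+-shift 4 3 a-z)) (sym (+-shift 2 2 z+2≡)) upper³
         , subst-leφ (sym a-z) (sym z+2≡) lower³

  band-w : band 2 1 w ≡ true × band 7 4 w ≡ false
  band-w = subst-leφ (sym a-w) (sym w+1≡) lower⁴
         , subst-leφ (sym (+-shift 2 5 a-w)) (sym (+-shift 1 3 w+1≡)) upper⁴

  inR-k+m : inR 1 (ℤ.+ 0) (k + m) ≡ true
  inR-k+m = inR-complete 1 (ℤ.+ 0) (k + m) m 1≤m (m≤n+m m k) (f-≡ 1 0 m (k + m) .from value)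
    where
    value : 1 * a m + 1 * m ≡ k + m + 0
    value = trans (cong (λ A → 1 * A + 1 * m) a≡k) (solve (k ∷ m ∷ []))

  inR-2k+m : inR 2 (ℤ.+ 0) (2 * k + m) ≡ true
  inR-2k+m = inR-complete 2 (ℤ.+ 0) (2 * k + m) m 1≤m (m≤n+m m (2 * k)) (f-≡ 2 0 m (2 * k + m) .from value)
    where
    value : 2 * a m + 1 * m ≡ 2 * k + m + 0
    value = trans (cong (λ A → 2 * A + 1 * m) a≡k) (solve (k ∷ m ∷ []))

  inR-z : inR 2 (ℤ.+ 2) z ≡ true
  inR-z = inR-complete 2 (ℤ.+ 2) z m 1≤m m≤z (f-≡ 2 2 m z .from value)
    where
    value : 2 * a m + 1 * m ≡ z + 2
    value = trans (cong (λ A → 2 * A + 1 * m) a≡k) (trans (cong (2 * k +_) (*-identityˡ m)) (sym z+2≡))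
    m≤z : m ≤ z
    m≤z = +-cancelʳ-≤ 2 m z (subst₂ _≤_ (+-comm 2 m) (sym z+2≡) (+-monoˡ-≤ m (*-monoʳ-≤ 2 1≤k)))

  inR-w : inR 3 (ℤ.+ 1) w ≡ true
  inR-w = inR-complete 3 (ℤ.+ 1) w m 1≤m m≤w (f-≡ 3 1 m w .from value)
    where
    value : 3 * a m + 2 * m ≡ w + 1
    value = trans (cong (λ A → 3 * A + 2 * m) a≡k) (sym w+1≡)
    m≤w : m ≤ w
    m≤w = +-cancelʳ-≤ 1 m w (subst₂ _≤_ (+-comm 1 m) (sym w+1≡)
      (+-mono-≤ (≤-trans 1≤k (m≤m+n k _)) (m≤m+n m (m + 0))))

band-R₁₀ : ∀ x → R 1 (ℤ.+ 0) x → band 2 1 x ≡ false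
band-R₁₀ x (m , 1≤m , eq) = subst (λ n → band 2 1 n ≡ false) position band-k+m
  where
  open Orbit 1≤m refl
  position : a m + m ≡ x
  position = trans (cong₂ _+_ (sym (*-identityˡ (a m))) (sym (*-identityˡ m)))
                   (trans (f-≡ 1 0 m x .to eq) (+-identityʳ x))

band-R₂₀ : ∀ x → R 2 (ℤ.+ 0) x → band 4 2 x ≡ true
band-R₂₀ x (m , 1≤m , eq) = subst (λ n → band 4 2 n ≡ true) position band-2k+m
  where
  open Orbit 1≤m refl
  position : 2 * a m + m ≡ x
  position = trans (cong (2 * a m +_) (sym (*-identityˡ m))) (trans (f-≡ 2 0 m x .to eq) (+-identityʳ x))

band-R₂₂ : ∀ x → R 2 (ℤ.+ 2) x → band 7 4 x ≡ true × band 4 2 x ≡ false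
band-R₂₂ x (m , 1≤m , eq) = subst (λ n → band 7 4 n ≡ true × band 4 2 n ≡ false) (sym x≡z) band-z
  where
  open Orbit 1≤m refl
  x≡z : x ≡ z
  x≡z = +-cancelʳ-≡ 2 x z
    (trans (sym (f-≡ 2 2 m x .to eq)) (trans (cong (2 * a m +_) (*-identityˡ m)) (sym z+2≡)))

band-R₃₁ : ∀ x → R 3 (ℤ.+ 1) x → band 2 1 x ≡ true × band 7 4 x ≡ false
band-R₃₁ x (m , 1≤m , eq) = subst (λ n → band 2 1 n ≡ true × band 7 4 n ≡ false) (sym x≡w) band-w
  where
  open Orbit 1≤m refl
  x≡w : x ≡ w
  x≡w = +-cancelʳ-≡ 1 x w (trans (sym (f-≡ 3 1 m x .to eq)) (sym w+1≡))

R₁₀-R₂₀-disjoint : ∀ x → R 1 (ℤ.+ 0) x → ¬ R 2 (ℤ.+ 0) x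
R₁₀-R₂₀-disjoint x r₁₀ r₂₀ = not-¬ (band-7-4⇒2-1 x (band-4-2⇒7-4 x (band-R₂₀ x r₂₀))) (band-R₁₀ x r₁₀)

R₂₂-R₂₀-disjoint : ∀ x → R 2 (ℤ.+ 2) x → ¬ R 2 (ℤ.+ 0) x
R₂₂-R₂₀-disjoint x r₂₂ r₂₀ = not-¬ (band-R₂₀ x r₂₀) (proj₂ (band-R₂₂ x r₂₂))

R₂₂-R₁₀-disjoint : ∀ x → R 2 (ℤ.+ 2) x → ¬ R 1 (ℤ.+ 0) x
R₂₂-R₁₀-disjoint x r₂₂ r₁₀ = not-¬ (band-7-4⇒2-1 x (proj₁ (band-R₂₂ x r₂₂))) (band-R₁₀ x r₁₀)

R₃₁-R₂₀-disjoint : ∀ x → R 3 (ℤ.+ 1) x → ¬ R 2 (ℤ.+ 0) x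
R₃₁-R₂₀-disjoint x r₃₁ r₂₀ = not-¬ (band-4-2⇒7-4 x (band-R₂₀ x r₂₀)) (proj₂ (band-R₃₁ x r₃₁))

R₃₁-R₁₀-disjoint : ∀ x → R 3 (ℤ.+ 1) x → ¬ R 1 (ℤ.+ 0) x
R₃₁-R₁₀-disjoint x r₃₁ r₁₀ = not-¬ (proj₁ (band-R₃₁ x r₃₁)) (band-R₁₀ x r₁₀)

R₃₁-R₂₂-disjoint : ∀ x → R 3 (ℤ.+ 1) x → ¬ R 2 (ℤ.+ 2) x
R₃₁-R₂₂-disjoint x r₃₁ r₂₂ = not-¬ (proj₁ (band-R₂₂ x r₂₂)) (proj₂ (band-R₃₁ x r₃₁))

if-true : ∀ {A : Set} {b} {u v : A} → b ≡ true → (if b then u else v) ≡ u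
if-true refl = refl

if-false : ∀ {A : Set} {b} {u v : A} → b ≡ false → (if b then u else v) ≡ v
if-false refl = refl

g-R₂₀ : ∀ x → inR 2 (ℤ.+ 0) x ≡ true → g x ≡ a x
g-R₂₀ x t = if-true t

g-R₁₀ : ∀ x → inR 1 (ℤ.+ 0) x ≡ true → g x ≡ a x ∸ 2
g-R₁₀ x t =
  trans (if-false (inR-false 2 (ℤ.+ 0) x (R₁₀-R₂₀-disjoint x (inR-sound 1 (ℤ.+ 0) x t))))
  (if-true t)

g-R₂₂ : ∀ x → inR 2 (ℤ.+ 2) x ≡ true → g x ≡ a x + 2 ∸ x
g-R₂₂ x t =
  trans (if-false (inR-false 2 (ℤ.+ 0) x (R₂₂-R₂₀-disjoint x r₂₂)))
  (trans (if-false (inR-false 1 (ℤ.+ 0) x (R₂₂-R₁₀-disjoint x r₂₂)))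
  (if-true t))
  where
  r₂₂ : R 2 (ℤ.+ 2) x
  r₂₂ = inR-sound 2 (ℤ.+ 2) x t

g-R₃₁ : ∀ x → inR 3 (ℤ.+ 1) x ≡ true → g x ≡ a x + 1 ∸ x
g-R₃₁ x t =
  trans (if-false (inR-false 2 (ℤ.+ 0) x (R₃₁-R₂₀-disjoint x r₃₁)))
  (trans (if-false (inR-false 1 (ℤ.+ 0) x (R₃₁-R₁₀-disjoint x r₃₁)))
  (trans (if-false (inR-false 2 (ℤ.+ 2) x (R₃₁-R₂₂-disjoint x r₃₁)))
  (if-true t)))
  where
  r₃₁ : R 3 (ℤ.+ 1) x
  r₃₁ = inR-sound 3 (ℤ.+ 1) x t

module Involution {k m : ℕ} (1≤m : 1 ≤ m) (a≡k : a m ≡ k) where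

  open Orbit 1≤m a≡k public

  g-k+m : g (k + m) ≡ z
  g-k+m = begin
    g (k + m)      ≡⟨ g-R₁₀ (k + m) inR-k+m ⟩
    a (k + m) ∸ 2  ≡⟨ cong (_∸ 2) (trans a-k+m (sym z+2≡)) ⟩
    z + 2 ∸ 2      ≡⟨ m+n∸n≡m z 2 ⟩
    z              ∎
    where open ≡-Reasoning

  g-z : g z ≡ k + m
  g-z = begin
    g z              ≡⟨ g-R₂₂ z inR-z ⟩
    a z + 2 ∸ z      ≡⟨ cong (_∸ z) (+-cancelʳ-≡ 2 (a z + 2) (k + m + z) shifted) ⟩
    k + m + z ∸ z    ≡⟨ m+n∸n≡m (k + m) z ⟩
    k + m            ∎
    where
    open ≡-Reasoning
    shifted : a z + 2 + 2 ≡ k + m + z + 2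
    shifted = begin
      a z + 2 + 2        ≡⟨ +-assoc (a z) 2 2 ⟩
      a z + 4            ≡⟨ a-z ⟩
      3 * k + 2 * m      ≡⟨ solve (k ∷ m ∷ []) ⟩
      k + m + (2 * k + m) ≡⟨ cong (k + m +_) (sym z+2≡) ⟩
      k + m + (z + 2)    ≡⟨ sym (+-assoc (k + m) z 2) ⟩
      k + m + z + 2      ∎

  g-2k+m : g (2 * k + m) ≡ w
  g-2k+m = trans (g-R₂₀ (2 * k + m) inR-2k+m) a-2k+m

  g-w : g w ≡ 2 * k + m
  g-w = begin
    g w                  ≡⟨ g-R₃₁ w inR-w ⟩
    a w + 1 ∸ w          ≡⟨ cong (_∸ w) (+-cancelʳ-≡ 1 (a w + 1) (2 * k + m + w) shifted) ⟩
    2 * k + m + w ∸ w    ≡⟨ m+n∸n≡m (2 * k + m) w ⟩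
    2 * k + m            ∎
    where
    open ≡-Reasoning
    shifted : a w + 1 + 1 ≡ 2 * k + m + w + 1
    shifted = begin
      a w + 1 + 1                ≡⟨ +-assoc (a w) 1 1 ⟩
      a w + 2                    ≡⟨ a-w ⟩
      5 * k + 3 * m              ≡⟨ solve (k ∷ m ∷ []) ⟩
      2 * k + m + (3 * k + 2 * m) ≡⟨ cong (2 * k + m +_) (sym w+1≡) ⟩
      2 * k + m + (w + 1)        ≡⟨ sym (+-assoc (2 * k + m) w 1) ⟩
      2 * k + m + w + 1          ∎

  1≤z : 1 ≤ z
  1≤z = +-cancelʳ-≤ 2 1 z (subst (3 ≤_) (sym z+2≡) (+-mono-≤ (*-monoʳ-≤ 2 1≤k) 1≤m))

  1≤w : 1 ≤ w
  1≤w = +-cancelʳ-≤ 1 1 w (subst (2 ≤_) (sym w+1≡) (≤-trans (s≤s (s≤s z≤n)) 5≤3k+2m))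

-- Classification

unstep² : ∀ X Y → Y ≤ X → X < 2 * Y →
  Σ ℕ λ k → Σ ℕ λ m → 1 ≤ m × 2 * k + m ≡ X × k + m ≡ Y
unstep² X Y Y≤X X<2Y with m≤n⇒∃[o]m+o≡n Y≤X
... | u , refl with m≤n⇒∃[o]m+o≡n (+-cancelˡ-< Y u Y (subst (Y + u <_) (cong (Y +_) (+-identityʳ Y)) X<2Y))
... | v , refl = u , suc v , s≤s z≤n , solve (u ∷ v ∷ []) , solve (u ∷ v ∷ [])


unstep³ : ∀ X Y → Y ≤ X → X ≤ 2 * Y → 3 * Y < 2 * X →
  Σ ℕ λ k → Σ ℕ λ m → 1 ≤ m × 3 * k + 2 * m ≡ X × 2 * k + m ≡ Y
unstep³ X Y Y≤X X≤2Y 3Y<2X with m≤n⇒∃[o]m+o≡n Y≤X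
... | u , refl with m≤n⇒∃[o]m+o≡n (+-cancelˡ-≤ Y u Y (subst (Y + u ≤_) (cong (Y +_) (+-identityʳ Y)) X≤2Y))
... | v , refl with m≤n⇒∃[o]m+o≡n (+-cancelˡ-< (3 * u + 2 * v) v u (let open ≤-Reasoning in begin-strict
      3 * u + 2 * v + v  ≡⟨ solve (u ∷ v ∷ []) ⟩
      3 * (u + v)        <⟨ 3Y<2X ⟩
      2 * (u + v + u)    ≡⟨ solve (u ∷ v ∷ []) ⟩
      3 * u + 2 * v + u  ∎))
... | w , refl = v , suc w , s≤s z≤n , solve (v ∷ w ∷ []) , solve (v ∷ w ∷ [])

unstep⁴ : ∀ X Y → Y ≤ X → X ≤ 2 * Y → 3 * Y ≤ 2 * X → 3 * X < 5 * Y →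
  Σ ℕ λ k → Σ ℕ λ m → 1 ≤ m × 5 * k + 3 * m ≡ X × 3 * k + 2 * m ≡ Y
unstep⁴ X Y Y≤X X≤2Y 3Y≤2X 3X<5Y with m≤n⇒∃[o]m+o≡n Y≤X
... | u , refl with m≤n⇒∃[o]m+o≡n (+-cancelˡ-≤ Y u Y (subst (Y + u ≤_) (cong (Y +_) (+-identityʳ Y)) X≤2Y))
... | v , refl with m≤n⇒∃[o]m+o≡n (+-cancelˡ-≤ (3 * u + 2 * v) v u (let open ≤-Reasoning in begin
      3 * u + 2 * v + v  ≡⟨ solve (u ∷ v ∷ []) ⟩
      3 * (u + v)        ≤⟨ 3Y≤2X ⟩
      2 * (u + v + u)    ≡⟨ solve (u ∷ v ∷ []) ⟩
      3 * u + 2 * v + u  ∎))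
... | w , refl with m≤n⇒∃[o]m+o≡n (+-cancelˡ-< (9 * v + 5 * w) w v (let open ≤-Reasoning in begin-strict
      9 * v + 5 * w + w                  ≡⟨ solve (v ∷ w ∷ []) ⟩
      3 * (v + w + v + (v + w))          <⟨ 3X<5Y ⟩
      5 * (v + w + v)                    ≡⟨ solve (v ∷ w ∷ []) ⟩
      9 * v + 5 * w + v                  ∎))
... | z , refl = w , suc z , s≤s z≤n , solve (w ∷ z ∷ []) , solve (w ∷ z ∷ [])

data Classified (n : ℕ) : Set where
  in-R₁₀ : ∀ {k m} → 1 ≤ m → a m ≡ k → n ≡ k + m → Classified n
  in-R₂₀ : ∀ {k m} → 1 ≤ m → a m ≡ k → n ≡ 2 * k + m → Classified n
  in-R₂₂ : ∀ {k m} → 1 ≤ m → a m ≡ k → n + 2 ≡ 2 * k + m → Classified n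
  in-R₃₁ : ∀ {k m} → 1 ≤ m → a m ≡ k → n + 1 ≡ 3 * k + 2 * m → Classified n

classify-R₁₀ : ∀ n → 1 ≤ n → band 2 1 n ≡ false → Classified n
classify-R₁₀ n 1≤n b₂₁ with unstep² (a n) n (n≤a[n] n) (a[n]<2n n 1≤n)
... | k , m , 1≤m , 2k+m≡ , k+m≡ = in-R₁₀ 1≤m (a-via-step² k m 1≤m
  (subst-leφ (sym 2k+m≡) (sym k+m≡) (a-below n))
  (subst-leφ (cong (_+ 2) (sym 2k+m≡)) (cong (_+ 1) (sym k+m≡)) b₂₁)) (sym k+m≡)

classify-R₃₁ : ∀ n → 1 ≤ n → band 2 1 n ≡ true → band 7 4 n ≡ false → Classified n
classify-R₃₁ n 1≤n b₂₁ b₇₄ with unstep⁴ (a n + 2) (n + 1) Y≤X X≤2Y 3Y≤2X 3X<5Y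
  where
  Y≤X : n + 1 ≤ a n + 2
  Y≤X = +-mono-≤ (n≤a[n] n) (s≤s z≤n)
  X≤2Y : a n + 2 ≤ 2 * (n + 1)
  X≤2Y = begin
    a n + 2        ≤⟨ +-monoˡ-≤ 2 (<⇒≤ (a[n]<2n n 1≤n)) ⟩
    2 * n + 2      ≡⟨ solve (n ∷ []) ⟩
    2 * (n + 1)    ∎
    where open ≤-Reasoning
  3Y≤2X : 3 * (n + 1) ≤ 2 * (a n + 2)
  3Y≤2X = begin
    3 * (n + 1)        ≡⟨ solve (n ∷ []) ⟩
    suc (3 * n) + 2    ≤⟨ +-monoˡ-≤ 2 (3n<2[1+a[n]] n 1≤n) ⟩
    2 * suc (a n) + 2  ≡⟨ double-suc (a n) ⟩
    2 * (a n + 2)      ∎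
    where
    open ≤-Reasoning
    double-suc : ∀ A → 2 * suc A + 2 ≡ 2 * (A + 2)
    double-suc = solve-∀
  3X<5Y : 3 * (a n + 2) < 5 * (n + 1)
  3X<5Y = subst₂ _<_ (*-comm (a n + 2) 3) (*-comm (n + 1) 5)
    (leφ-separates (a n + 2) (n + 1) 5 3 (m≤n+m 1 n) (s≤s z≤n) b₂₁ refl)
... | k , m , 1≤m , 5k+3m≡ , 3k+2m≡ = in-R₃₁ 1≤m (a-via-step⁴ k m 1≤m
  (subst-leφ (sym 5k+3m≡) (sym 3k+2m≡) b₂₁)
  (subst-leφ (+-shift 2 5 (sym 5k+3m≡)) (+-shift 1 3 (sym 3k+2m≡)) b₇₄)) (sym 3k+2m≡)

-- Both remaining classes invert (1 + a n, n) = S³(k, m); R₂₂ then uses (a n + 4, n + 2) = S³(k + 1, m).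
unstep³-a : ∀ n → 1 ≤ n → Σ ℕ λ k → Σ ℕ λ m → 1 ≤ m × 3 * k + 2 * m ≡ suc (a n) × 2 * k + m ≡ n
unstep³-a n 1≤n =
  unstep³ (suc (a n)) n (≤-trans (n≤a[n] n) (n≤1+n (a n))) (a[n]<2n n 1≤n) (3n<2[1+a[n]] n 1≤n)

classify-R₂₀ : ∀ n → 1 ≤ n → band 4 2 n ≡ true → Classified n
classify-R₂₀ n 1≤n b₄₂ with unstep³-a n 1≤n
... | k , m , 1≤m , 3k+2m≡ , 2k+m≡ = in-R₂₀ 1≤m (a-via-step³ k m 1≤m
  (subst-leφ (sym 3k+2m≡) (sym 2k+m≡) (a-above n))
  (subst-leφ (sym (trans (cong (_+ 3) 3k+2m≡) (sym (+-suc (a n) 3)))) (sym (cong (_+ 2) 2k+m≡)) b₄₂))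
  (sym 2k+m≡)

classify-R₂₂ : ∀ n → 1 ≤ n → band 7 4 n ≡ true → band 4 2 n ≡ false → Classified n
classify-R₂₂ n 1≤n b₇₄ b₄₂ with unstep³-a n 1≤n
... | k , m , 1≤m , 3k+2m≡ , 2k+m≡ = in-R₂₂ 1≤m (a-via-step³ (suc k) m 1≤m
  (subst-leφ (sym X≡) (sym Y≡) b₄₂)
  (subst-leφ (sym (trans (cong (_+ 3) X≡) (+-assoc (a n) 4 3)))
             (sym (trans (cong (_+ 2) Y≡) (+-assoc n 2 2))) b₇₄))
  (sym Y≡)
  where
  X≡ : 3 * suc k + 2 * m ≡ a n + 4
  X≡ = begin
    3 * suc k + 2 * m   ≡⟨ solve (k ∷ m ∷ []) ⟩
    3 * k + 2 * m + 3   ≡⟨ cong (_+ 3) 3k+2m≡ ⟩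
    suc (a n) + 3       ≡⟨ sym (+-suc (a n) 3) ⟩
    a n + 4             ∎
    where open ≡-Reasoning
  Y≡ : 2 * suc k + m ≡ n + 2
  Y≡ = begin
    2 * suc k + m   ≡⟨ solve (k ∷ m ∷ []) ⟩
    2 * k + m + 2   ≡⟨ cong (_+ 2) 2k+m≡ ⟩
    n + 2           ∎
    where open ≡-Reasoning

classify : ∀ n → 1 ≤ n → Classified n
classify n 1≤n with band 2 1 n in b₂₁ | band 7 4 n in b₇₄ | band 4 2 n in b₄₂
... | false | _     | _     = classify-R₁₀ n 1≤n b₂₁
... | true  | false | _     = classify-R₃₁ n 1≤n b₂₁ b₇₄
... | true  | true  | false = classify-R₂₂ n 1≤n b₇₄ b₄₂
... | true  | true  | true  = classify-R₂₀ n 1≤n b₄₂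

HasPartner : ℕ → Set
HasPartner n = Σ ℕ λ n′ → 1 ≤ n′ × g n ≡ n′ × g n′ ≡ n

partner : ∀ n → Classified n → HasPartner n
partner n (in-R₁₀ 1≤m a≡k refl) = z , 1≤z , g-k+m , g-z
  where open Involution 1≤m a≡k
partner n (in-R₂₀ 1≤m a≡k refl) = w , 1≤w , g-2k+m , g-w
  where open Involution 1≤m a≡k
partner n (in-R₂₂ {k} {m} 1≤m a≡k n+2≡) =
  subst HasPartner (sym (+-cancelʳ-≡ 2 n z (trans n+2≡ (sym z+2≡)))) (k + m , 1≤k+m , g-z , g-k+m)
  where open Involution 1≤m a≡k
partner n (in-R₃₁ {k} {m} 1≤m a≡k n+1≡) =
  subst HasPartner (sym (+-cancelʳ-≡ 1 n w (trans n+1≡ (sym w+1≡)))) (2 * k + m , 1≤2k+m , g-w , g-2k+m)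
  where
  open Involution 1≤m a≡k
  1≤2k+m : 1 ≤ 2 * k + m
  1≤2k+m = ≤-trans 1≤m (m≤n+m m (2 * k))

theorem4p2 : ((n : ℕ) → 1 ≤ n → 1 ≤ g n)
    × ((n : ℕ) → 1 ≤ n → g (g n) ≡ n)
    × Σ ℕ (λ n → 1 ≤ n × g n ≢ n)
theorem4p2 = positive , involutive , (1 , s≤s z≤n , λ ())
  where
  positive : (n : ℕ) → 1 ≤ n → 1 ≤ g n
  positive n 1≤n with partner n (classify n 1≤n)
  ... | n′ , 1≤n′ , gn≡n′ , _ = subst (1 ≤_) (sym gn≡n′) 1≤n′
  involutive : (n : ℕ) → 1 ≤ n → g (g n) ≡ n
  involutive n 1≤n with partner n (classify n 1≤n)
  ... | _ , _ , gn≡n′ , gn′≡n = trans (cong g gn≡n′) gn′≡n
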